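{- Let $\mathcal{B}$ be a connected building set on a finite set $E$ which is closed under intersection. Then every generating subset of $\mathcal{B}$ contains the set $\mathcal{P}(\mathcal{B})$ of all $\mathcal{B}$-paths.
   Context: A building set on $E$ is a collection $\mathcal{B}$ of non-empty subsets of $E$ closed under union of intersecting members and containing all singletons; connected means $E\in\mathcal{B}$; closed under intersection means $B\cap B'\in\mathcal{B}\cup\{\varnothing\}$ for all $B,B'\in\mathcal{B}$. For $s,t\in E$ (possibly equal), the $\mathcal{B}$-path $P(s,t)$ is the smallest element of $\mathcal{B}$ containing $\{s,t\}$, and $\mathcal{P}(\mathcal{B})=\{P(s,t):s,t\in E\}$. A subset $\mathcal{C}\subseteq\mathcal{B}$ is generating if for each $B\in\mathcal{B}$ and each $b\in B$, $B$ is the union of the sets $C\in\mathcal{C}$ with $b\in C\subseteq B$. -}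

module Defs where

open import Level using (Level; suc; _⊔_)
open import Data.Nat using (ℕ)
open import Data.Fin using (Fin)
open import Data.Fin.Subset using (Subset; _∈_; _⊆_; _∩_; _∪_; ⁅_⁆; ⊤; Nonempty; Empty)
open import Data.Product using (Σ; _×_; ∃)
open import Data.Sum using (_⊎_)

Family : ℕ → Set₁
Family n = Subset n → Set

record IsBuildingSet {n : ℕ} (𝓑 : Family n) : Set where
  field
    nonempty    : ∀ B → 𝓑 B → Nonempty B
    union-closed : ∀ B B′ → 𝓑 B → 𝓑 B′ → Nonempty (B ∩ B′) → 𝓑 (B ∪ B′)
    singletons  : ∀ (i : Fin n) → 𝓑 ⁅ i ⁆

Connected : {n : ℕ} → Family n → Set
Connected 𝓑 = 𝓑 ⊤

IntersectionClosed : {n : ℕ} → Family n → Set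
IntersectionClosed 𝓑 = ∀ B B′ → 𝓑 B → 𝓑 B′ → 𝓑 (B ∩ B′) ⊎ Empty (B ∩ B′)

IsPath : {n : ℕ} → Family n → Fin n → Fin n → Subset n → Set
IsPath 𝓑 s t P =
  𝓑 P × s ∈ P × t ∈ P × (∀ Q → 𝓑 Q → s ∈ Q → t ∈ Q → P ⊆ Q)

Paths : {n : ℕ} → Family n → Family n
Paths 𝓑 P = ∃ λ s → ∃ λ t → IsPath 𝓑 s t P

SubFamily : {n : ℕ} → Family n → Family n → Set
SubFamily 𝓒 𝓑 = ∀ C → 𝓒 C → 𝓑 C

-- 𝓒 ⊆ 𝓑 is generating: for B ∈ 𝓑 and b ∈ B, B equals the union of all
-- C ∈ 𝓒 with b ∈ C ⊆ B (stated pointwise as equality of sets).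
Generating : {n : ℕ} → Family n → Family n → Set
Generating 𝓑 𝓒 =
  SubFamily 𝓒 𝓑 ×
  (∀ B b → 𝓑 B → b ∈ B →
     (∀ x → x ∈ B → ∃ λ C → 𝓒 C × b ∈ C × C ⊆ B × x ∈ C) ×
     (∀ x → (∃ λ C → 𝓒 C × b ∈ C × C ⊆ B × x ∈ C) → x ∈ B))

module Submission where

open import Defs
open import Data.Nat using (ℕ)
open import Data.Fin using (Fin)
open import Data.Fin.Subset using (Subset; _∈_; _⊆_)
open import Data.Fin.Subset.Properties using (⊆-antisym)
open import Data.Product using (∃; _×_; _,_; proj₁; proj₂)
open import Relation.Binary.PropositionalEquality using (subst)

-- Generating P from s yields a generator C ∈ 𝓒 with s, t ∈ C ⊆ P; since P is the
-- smallest member of 𝓑 containing s and t, C = P.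

module _ {n : ℕ} {𝓑 𝓒 : Family n} (generating : Generating 𝓑 𝓒) where

  generator-through : ∀ {B : Subset n} {s t : Fin n} → 𝓑 B → s ∈ B → t ∈ B →
                      ∃ λ C → 𝓒 C × s ∈ C × C ⊆ B × t ∈ C
  generator-through {B} {s} {t} B∈𝓑 s∈B t∈B =
    proj₁ (proj₂ generating B s B∈𝓑 s∈B) t t∈B

  paths⊆generating : ∀ P → Paths 𝓑 P → 𝓒 P
  paths⊆generating P (s , t , P∈𝓑 , s∈P , t∈P , P-minimal)
    with generator-through P∈𝓑 s∈P t∈P
  ... | C , C∈𝓒 , s∈C , C⊆P , t∈C =
    subst 𝓒 (⊆-antisym C⊆P (P-minimal C (proj₁ generating C C∈𝓒) s∈C t∈C)) C∈𝓒

lemma4p6 : (n : ℕ) (𝓑 : Family n) → IsBuildingSet 𝓑 → Connected 𝓑 → IntersectionClosed 𝓑 →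
    (𝓒 : Family n) → Generating 𝓑 𝓒 → ∀ P → Paths 𝓑 P → 𝓒 P
lemma4p6 n 𝓑 _ _ _ 𝓒 generating = paths⊆generating generating
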